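{- Let $X$ be a non-empty finite set, $k\ge 1$ an integer, and $\mathscr{C}$ a clustering system on $X$. Then $\mathscr{C}$ is pre-$k$-ary if and only if there is a DAG $G$ with leaf set $X$ such that $\mathscr{C}=\mathscr{C}_G$ and $G$ has the $k$-$\mathrm{lca}$-property.
   Context: $X^{(k)}$ denotes the set of non-empty subsets of $X$ of cardinality at most $k$. A clustering system on $X$ is a set system $\mathscr{C}$ of non-empty subsets of $X$ with $\{x\}\in\mathscr{C}$ for all $x\in X$ and $X\in\mathscr{C}$. A set system $\mathscr{C}$ on $X$ is pre-$k$-ary if for every $U\in X^{(k)}$ the set $\bigcap\{C\in\mathscr{C}\mid U\subseteq C\}$ belongs to $\mathscr{C}$. For a finite DAG $G$, write $v\preceq w$ if there is a directed path (possibly of length $0$) from $w$ to $v$. The leaf set $L(G)$ is the set of $\preceq$-minimal vertices. For a vertex $v$, its cluster is $\mathrm{C}(v)=\{x\in L(G)\mid x\preceq v\}$, and $\mathscr{C}_G=\{\mathrm{C}(v)\mid v\in V(G)\}$. For $Y\subseteq V(G)$, a least common ancestor of $Y$ is a $\preceq$-minimal element of the set of common ancestors $\{w\in V(G)\mid y\preceq w \text{ for all } y\in Y\}$; $\mathrm{LCA}(Y)$ is the set of all of them, and $\mathrm{lca}(Y)$ is said to be defined (and equals $q$) if $\mathrm{LCA}(Y)=\{q\}$. $G$ has the $k$-$\mathrm{lca}$-property if $\mathrm{lca}(A)$ is defined for all $A\in L(G)^{(k)}$. -}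

module Defs where

open import Data.Nat using (ℕ; suc; _≤_)
open import Data.Fin using (Fin)
open import Data.Fin.Subset using (Subset; _∈_; _⊆_; ∣_∣; Nonempty; ⁅_⁆; ⊤)
open import Data.Bool using (Bool; T)
open import Data.List using (List)
import Data.List.Membership.Propositional as L
open import Data.Product using (Σ; ∃; _×_)
open import Relation.Binary.PropositionalEquality using (_≡_)
open import Relation.Nullary using (¬_)
open import Function.Bundles using (_⇔_)

-- A set system on X = Fin n is a finite list of subsets (membership is
-- propositional list membership; duplicates are irrelevant).
SetSystem : ℕ → Set
SetSystem n = List (Subset n)

IsClusteringSystem : ∀ {n} → SetSystem n → Set
IsClusteringSystem {n} 𝒞 =
  (∀ C → C L.∈ 𝒞 → Nonempty C) × ((x : Fin n) → ⁅ x ⁆ L.∈ 𝒞) × (⊤ L.∈ 𝒞)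

IsIntersectionAbove : ∀ {n} → SetSystem n → Subset n → Subset n → Set
IsIntersectionAbove {n} 𝒞 U D =
  (x : Fin n) → (x ∈ D ⇔ (∀ C → C L.∈ 𝒞 → U ⊆ C → x ∈ C))

PreKary : ∀ {n} → ℕ → SetSystem n → Set
PreKary {n} k 𝒞 =
  (U : Subset n) → Nonempty U → ∣ U ∣ ≤ k →
  Σ (Subset n) λ D → D L.∈ 𝒞 × IsIntersectionAbove 𝒞 U D

data Path {m : ℕ} (E : Fin m → Fin m → Bool) : Fin m → Fin m → Set where
  here : ∀ {u} → Path E u u
  step : ∀ {u w v} → T (E u w) → Path E w v → Path E u v

record DAG : Set where
  field
    m       : ℕ
    E       : Fin m → Fin m → Bool
    acyclic : ∀ u w → T (E u w) → ¬ Path E w u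

  Vertex : Set
  Vertex = Fin m

  _⪯_ : Vertex → Vertex → Set
  v ⪯ w = Path E w v

  IsLeaf : Vertex → Set
  IsLeaf v = ∀ w → w ⪯ v → w ≡ v

open DAG public

-- G has leaf set X = Fin n, via an injective identification of X with L(G).
HasLeafSet : (G : DAG) → (n : ℕ) → (Fin n → Vertex G) → Set
HasLeafSet G n leaf =
  (∀ x y → leaf x ≡ leaf y → x ≡ y) ×
  (∀ v → IsLeaf G v ⇔ ∃ λ x → leaf x ≡ v)

IsClusterOf : (G : DAG) → ∀ {n} → (Fin n → Vertex G) → Vertex G → Subset n → Set
IsClusterOf G {n} leaf v S = (x : Fin n) → (x ∈ S ⇔ _⪯_ G (leaf x) v)

ClustersEqual : (G : DAG) → ∀ {n} → (Fin n → Vertex G) → SetSystem n → Set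
ClustersEqual G leaf 𝒞 =
  (∀ S → S L.∈ 𝒞 → ∃ λ v → IsClusterOf G leaf v S) ×
  (∀ v → ∃ λ S → S L.∈ 𝒞 × IsClusterOf G leaf v S)

IsCommonAncestor : (G : DAG) → ∀ {n} → (Fin n → Vertex G) → Subset n → Vertex G → Set
IsCommonAncestor G leaf A w = ∀ x → x ∈ A → _⪯_ G (leaf x) w

IsLCA : (G : DAG) → ∀ {n} → (Fin n → Vertex G) → Subset n → Vertex G → Set
IsLCA G leaf A q =
  IsCommonAncestor G leaf A q ×
  (∀ w → IsCommonAncestor G leaf A w → _⪯_ G w q → w ≡ q)

LcaDefined : (G : DAG) → ∀ {n} → (Fin n → Vertex G) → Subset n → Set
LcaDefined G leaf A =
  Σ (Vertex G) λ q → IsLCA G leaf A q × (∀ q' → IsLCA G leaf A q' → q' ≡ q)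

HasKLcaProperty : (G : DAG) → ∀ {n} → (Fin n → Vertex G) → ℕ → Set
HasKLcaProperty G {n} leaf k =
  (A : Subset n) → Nonempty A → ∣ A ∣ ≤ k → LcaDefined G leaf A

-- If G has the k-lca-property and |U| ≤ k, the cluster of lca(U) is
-- ⋂{C ∈ 𝒞 | U ⊆ C}: a cluster C(v) containing U has v as a common ancestor of
-- U, and below v there is a ⪯-minimal common ancestor (G is finite and
-- acyclic), which must be lca(U). Conversely, for a pre-k-ary clustering
-- system take the DAG whose vertices are the distinct members of 𝒞, with an
-- edge from C to C' whenever C' ⊊ C. Then C(v) is the member v itself, the
-- singletons are the leaves, and the common ancestors of A are the members
-- containing A, so the intersection of those members is their unique least one.
module Submission where

open import Defs
open import Data.Nat using (ℕ; suc; _≤_)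
open import Data.Fin using (Fin; zero; suc)
open import Data.Product using (Σ; _×_)
open import Function.Bundles using (_⇔_)

open import Data.Bool using (Bool; T)
import Data.Bool as Bool
open import Data.Empty using (⊥-elim)
open import Data.Fin.Induction using (spo-wellFounded)
open import Data.Fin.Subset using (Subset; _∈_; _⊆_; ⁅_⁆; Nonempty)
open import Data.Fin.Subset.Properties using (_∈?_; _⊆?_; ⊆-antisym; x∈⁅x⁆; x∈⁅y⁆⇒x≡y)
open import Data.List using (List; length; lookup; deduplicate)
import Data.List.Membership.Propositional as List
open import Data.List.Membership.Propositional.Properties using (∈-lookup; ∈-deduplicate⁺; ∈-deduplicate⁻)
open import Data.List.Relation.Unary.All as All using ()
open import Data.List.Relation.Unary.AllPairs using (_∷_)
open import Data.List.Relation.Unary.Any using (index)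
open import Data.List.Relation.Unary.Any.Properties using (lookup-index)
open import Data.List.Relation.Unary.Unique.Propositional using (Unique)
open import Data.Product using (_,_; proj₁; proj₂; ∃)
open import Data.Vec.Properties using (≡-dec)
open import Function.Bundles using (mk⇔; Equivalence)
open import Induction.WellFounded using (WellFounded; Acc; acc)
open import Relation.Binary.PropositionalEquality
  using (_≡_; _≢_; refl; sym; trans; cong; subst; resp₂)
open import Relation.Binary.PropositionalEquality.Properties using (isEquivalence)
open import Relation.Nullary using (¬_; Dec; yes; no; ¬?)
open import Relation.Nullary.Decidable using (⌊_⌋; toWitness; fromWitness; _×-dec_; decidable-stable)

_++ₚ_ : ∀ {m} {E : Fin m → Fin m → Bool} {u v w} → Path E u v → Path E v w → Path E u w
here     ++ₚ q = q
step e p ++ₚ q = step e (p ++ₚ q)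

module _ (G : DAG) where

  _≺_ : Vertex G → Vertex G → Set
  w ≺ v = ∃ λ u → T (E G v u) × Path (E G) u w

  ≺-wellFounded : WellFounded _≺_
  ≺-wellFounded = spo-wellFounded record
    { isEquivalence = isEquivalence
    ; irrefl        = λ { refl (u , e , p) → acyclic G _ u e p }
    ; trans         = λ { (u , e , p) (u′ , e′ , p′) → u′ , e′ , (p′ ++ₚ step e p) }
    ; <-resp-≈      = resp₂ _≺_
    }

  Minimal : (Vertex G → Set) → Vertex G → Set
  Minimal P q = ∀ w → P w → _⪯_ G w q → w ≡ q

  -- Minimality is not decidable here, so the descent only yields a
  -- double-negated witness; this suffices because membership in a subset is.
  ¬¬-minimal-below : (P : Vertex G → Set) → ∀ {v} → P v →
                     ¬ ¬ (∃ λ q → (P q × Minimal P q) × _⪯_ G q v)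
  ¬¬-minimal-below P = descend (≺-wellFounded _)
    where
    descend : ∀ {v} → Acc _≺_ v → P v → ¬ ¬ (∃ λ q → (P q × Minimal P q) × _⪯_ G q v)
    descend {v} (acc below) Pv ¬found = ¬found (v , (Pv , minimal) , here)
      where
      minimal : Minimal P v
      minimal w Pw here       = refl
      minimal w Pw (step e p) = ⊥-elim (descend (below (_ , e , p)) Pw
        λ { (q , q-min , q⪯w) → ¬found (q , q-min , (step e p ++ₚ q⪯w)) })

  unique-lca-⪯-commonAncestor :
    ∀ {n} {leaf : Fin n → Vertex G} {A q} → (∀ q′ → IsLCA G leaf A q′ → q′ ≡ q) →
    ∀ v → IsCommonAncestor G leaf A v → ¬ ¬ (_⪯_ G q v)
  unique-lca-⪯-commonAncestor uniq v v-ca ¬q⪯v =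
    ¬¬-minimal-below (IsCommonAncestor G _ _) v-ca
      λ { (q′ , q′-lca , q′⪯v) → ¬q⪯v (subst (λ q → _⪯_ G q v) (uniq q′ q′-lca) q′⪯v) }

  preKary-from-lcaProperty :
    ∀ {n} (leaf : Fin n → Vertex G) (k : ℕ) (𝒞 : SetSystem n) →
    ClustersEqual G leaf 𝒞 → HasKLcaProperty G leaf k → PreKary k 𝒞
  preKary-from-lcaProperty leaf k 𝒞 (cluster-vertex , vertex-cluster) lca U U≢∅ ∣U∣≤k
    with lca U U≢∅ ∣U∣≤k
  ... | q , (q-ca , _) , uniq with vertex-cluster q
  ... | D , D∈𝒞 , D-cluster = D , D∈𝒞 , λ x → mk⇔ (∈-all-above x) (λ x∈all → x∈all D D∈𝒞 U⊆D)
    where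
    U⊆D : U ⊆ D
    U⊆D {y} y∈U = Equivalence.from (D-cluster y) (q-ca y y∈U)

    ∈-all-above : ∀ x → x ∈ D → ∀ C → C List.∈ 𝒞 → U ⊆ C → x ∈ C
    ∈-all-above x x∈D C C∈𝒞 U⊆C with cluster-vertex C C∈𝒞
    ... | v , C-cluster = decidable-stable (x ∈? C) λ x∉C →
      unique-lca-⪯-commonAncestor uniq v
        (λ y y∈U → Equivalence.to (C-cluster y) (U⊆C y∈U))
        (λ q⪯v → x∉C (Equivalence.from (C-cluster x)
                        (q⪯v ++ₚ Equivalence.to (D-cluster x) x∈D)))

Unique⇒lookup-injective : ∀ {A : Set} {xs : List A} → Unique xs →
                          ∀ i j → lookup xs i ≡ lookup xs j → i ≡ j
Unique⇒lookup-injective (_ ∷ _) zero zero _ = refl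
Unique⇒lookup-injective (x∉xs ∷ _) zero (suc j) eq = ⊥-elim (All.lookup x∉xs (∈-lookup j) eq)
Unique⇒lookup-injective (x∉xs ∷ _) (suc i) zero eq = ⊥-elim (All.lookup x∉xs (∈-lookup i) (sym eq))
Unique⇒lookup-injective (_ ∷ u) (suc i) (suc j) eq = cong suc (Unique⇒lookup-injective u i j eq)

_≟ₛ_ : ∀ {n} → (p q : Subset n) → Dec (p ≡ q)
_≟ₛ_ = ≡-dec Bool._≟_

∈⇔⁅⁆⊆ : ∀ {n} {x : Fin n} {p} → x ∈ p ⇔ ⁅ x ⁆ ⊆ p
∈⇔⁅⁆⊆ {x = x} {p} = mk⇔ (λ x∈p {y} y∈⁅x⁆ → subst (_∈ p) (sym (x∈⁅y⁆⇒x≡y x y∈⁅x⁆)) x∈p)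
                             (λ ⁅x⁆⊆p → ⁅x⁆⊆p (x∈⁅x⁆ x))

nonempty-⊆-⁅⁆ : ∀ {n} {x : Fin n} {p} → Nonempty p → p ⊆ ⁅ x ⁆ → p ≡ ⁅ x ⁆
nonempty-⊆-⁅⁆ {x = x} (y , y∈p) p⊆⁅x⁆ =
  ⊆-antisym p⊆⁅x⁆ (Equivalence.to ∈⇔⁅⁆⊆ (subst (_∈ _) (x∈⁅y⁆⇒x≡y x (p⊆⁅x⁆ y∈p)) y∈p))

module InclusionDAG {n} (𝒞 : SetSystem n) where

  members : List (Subset n)
  members = deduplicate _≟ₛ_ 𝒞

  cl : Fin (length members) → Subset n
  cl = lookup members

  cl-injective : ∀ i j → cl i ≡ cl j → i ≡ j
  cl-injective = Unique⇒lookup-injective (deduplicate-! 𝒞)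
    where open import Data.List.Relation.Unary.Unique.DecPropositional.Properties (_≟ₛ_ {n})

  cl∈𝒞 : ∀ i → cl i List.∈ 𝒞
  cl∈𝒞 i = ∈-deduplicate⁻ _≟ₛ_ 𝒞 (∈-lookup i)

  vertexOf : ∀ {C} → C List.∈ 𝒞 → Fin (length members)
  vertexOf C∈𝒞 = index (∈-deduplicate⁺ _≟ₛ_ C∈𝒞)

  cl-vertexOf : ∀ {C} (C∈𝒞 : C List.∈ 𝒞) → cl (vertexOf C∈𝒞) ≡ C
  cl-vertexOf C∈𝒞 = sym (lookup-index (∈-deduplicate⁺ _≟ₛ_ C∈𝒞))

  ⊊? : ∀ i j → Dec (cl j ⊆ cl i × cl j ≢ cl i)
  ⊊? i j = (cl j ⊆? cl i) ×-dec ¬? (cl j ≟ₛ cl i)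

  edge : Fin (length members) → Fin (length members) → Bool
  edge i j = ⌊ ⊊? i j ⌋

  Path⇒⊇ : ∀ {i j} → Path edge i j → cl j ⊆ cl i
  Path⇒⊇ here       = λ x∈ → x∈
  Path⇒⊇ (step e p) = λ x∈ → proj₁ (toWitness e) (Path⇒⊇ p x∈)

  ⊇⇒Path : ∀ {i j} → cl j ⊆ cl i → Path edge i j
  ⊇⇒Path {i} {j} cl-j⊆cl-i with cl j ≟ₛ cl i
  ... | yes eq = subst (Path edge i) (sym (cl-injective j i eq)) here
  ... | no neq = step (fromWitness {a? = ⊊? i j} (cl-j⊆cl-i , neq)) here

  inclusionDAG : DAG
  inclusionDAG = record
    { m       = length members
    ; E       = edge
    ; acyclic = λ i j e p → proj₂ (toWitness e) (⊆-antisym (proj₁ (toWitness e)) (Path⇒⊇ p))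
    }

  ⪯-antisym : ∀ {i j} → _⪯_ inclusionDAG i j → _⪯_ inclusionDAG j i → i ≡ j
  ⪯-antisym j→i i→j = cl-injective _ _ (⊆-antisym (Path⇒⊇ j→i) (Path⇒⊇ i→j))

module ClusteringDAG {n} (𝒞 : SetSystem n) (𝒞-clustering : IsClusteringSystem 𝒞) where
  open InclusionDAG 𝒞

  private
    G = inclusionDAG
    nonempty = proj₁ 𝒞-clustering
    singleton∈𝒞 = proj₁ (proj₂ 𝒞-clustering)

  leaf : Fin n → Vertex G
  leaf x = vertexOf (singleton∈𝒞 x)

  cl-leaf : ∀ x → cl (leaf x) ≡ ⁅ x ⁆
  cl-leaf x = cl-vertexOf (singleton∈𝒞 x)

  ∈cl⇔leaf⪯ : ∀ x v → x ∈ cl v ⇔ _⪯_ G (leaf x) v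
  ∈cl⇔leaf⪯ x v = mk⇔
    (λ x∈ → ⊇⇒Path (subst (_⊆ cl v) (sym (cl-leaf x)) (Equivalence.to ∈⇔⁅⁆⊆ x∈)))
    (λ p → Equivalence.from ∈⇔⁅⁆⊆ (subst (_⊆ cl v) (cl-leaf x) (Path⇒⊇ p)))

  leaf-injective : ∀ x y → leaf x ≡ leaf y → x ≡ y
  leaf-injective x y eq = x∈⁅y⁆⇒x≡y y (subst (x ∈_) ⁅x⁆≡⁅y⁆ (x∈⁅x⁆ x))
    where
    ⁅x⁆≡⁅y⁆ : ⁅ x ⁆ ≡ ⁅ y ⁆
    ⁅x⁆≡⁅y⁆ = trans (sym (cl-leaf x)) (trans (cong cl eq) (cl-leaf y))

  isLeaf⇔leaf : ∀ v → IsLeaf G v ⇔ ∃ λ x → leaf x ≡ v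
  isLeaf⇔leaf v = mk⇔ to from
    where
    to : IsLeaf G v → ∃ λ x → leaf x ≡ v
    to minimal with nonempty (cl v) (cl∈𝒞 v)
    ... | x , x∈ = x , minimal (leaf x) (Equivalence.to (∈cl⇔leaf⪯ x v) x∈)
    from : (∃ λ x → leaf x ≡ v) → IsLeaf G v
    from (x , refl) w w⪯leaf = cl-injective w (leaf x)
      (trans (nonempty-⊆-⁅⁆ (nonempty (cl w) (cl∈𝒞 w))
                            (subst (cl w ⊆_) (cl-leaf x) (Path⇒⊇ w⪯leaf)))
             (sym (cl-leaf x)))

  clustersEqual : ClustersEqual G leaf 𝒞
  clustersEqual =
    (λ C C∈𝒞 → vertexOf C∈𝒞 , subst (IsClusterOf G leaf (vertexOf C∈𝒞)) (cl-vertexOf C∈𝒞)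
                                      (λ x → ∈cl⇔leaf⪯ x (vertexOf C∈𝒞)))
    , λ v → cl v , cl∈𝒞 v , λ x → ∈cl⇔leaf⪯ x v

  commonAncestor⇔⊆ : ∀ {A} w → IsCommonAncestor G leaf A w ⇔ A ⊆ cl w
  commonAncestor⇔⊆ w = mk⇔ (λ ca {x} x∈A → Equivalence.from (∈cl⇔leaf⪯ x w) (ca x x∈A))
                           (λ A⊆ x x∈A → Equivalence.to (∈cl⇔leaf⪯ x w) (A⊆ x∈A))

  lca-of-intersection : ∀ {A D} → D List.∈ 𝒞 → IsIntersectionAbove 𝒞 A D → LcaDefined G leaf A
  lca-of-intersection {A} D∈𝒞 D-int = q , (q-ca , q-minimal) , unique
    where
    q = vertexOf D∈𝒞

    q-ca : IsCommonAncestor G leaf A q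
    q-ca = Equivalence.from (commonAncestor⇔⊆ q) λ {x} x∈A →
      subst (x ∈_) (sym (cl-vertexOf D∈𝒞)) (Equivalence.from (D-int x) λ _ _ A⊆C → A⊆C x∈A)

    q⪯commonAncestor : ∀ w → IsCommonAncestor G leaf A w → _⪯_ G q w
    q⪯commonAncestor w w-ca = ⊇⇒Path λ {x} x∈cl-q →
      Equivalence.to (D-int x) (subst (x ∈_) (cl-vertexOf D∈𝒞) x∈cl-q) (cl w) (cl∈𝒞 w)
        (Equivalence.to (commonAncestor⇔⊆ w) w-ca)

    q-minimal : Minimal G (IsCommonAncestor G leaf A) q
    q-minimal w w-ca w⪯q = ⪯-antisym w⪯q (q⪯commonAncestor w w-ca)

    unique : ∀ q′ → IsLCA G leaf A q′ → q′ ≡ q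
    unique q′ (q′-ca , q′-minimal) = sym (q′-minimal q q-ca (q⪯commonAncestor q′ q′-ca))

  lcaProperty : ∀ {k} → PreKary k 𝒞 → HasKLcaProperty G leaf k
  lcaProperty preKary A A≢∅ ∣A∣≤k with preKary A A≢∅ ∣A∣≤k
  ... | D , D∈𝒞 , D-int = lca-of-intersection D∈𝒞 D-int

theorem1 : (n k : ℕ) → 1 ≤ k → (𝒞 : SetSystem (suc n)) → IsClusteringSystem 𝒞 →
  (PreKary k 𝒞 ⇔
    Σ DAG λ G → Σ (Fin (suc n) → Vertex G) λ leaf →
      HasLeafSet G (suc n) leaf × ClustersEqual G leaf 𝒞 × HasKLcaProperty G leaf k)
-- Neither direction uses 1 ≤ k.
theorem1 n k _ 𝒞 𝒞-clustering = mk⇔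
  (λ preKary → inclusionDAG , leaf , (leaf-injective , isLeaf⇔leaf) , clustersEqual , lcaProperty preKary)
  (λ { (G , leaf , _ , clusters , lca) → preKary-from-lcaProperty G leaf k 𝒞 clusters lca })
  where
  open InclusionDAG 𝒞
  open ClusteringDAG 𝒞 𝒞-clustering
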